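{- Let $(P,\le,*)$ be a relatively pseudocomplemented poset, $a,b\in P$, and let $\Theta$ be an equivalence relation on $P$ compatible with $*$. Then: (i) if $(a,b)\in\Theta$ then $a*b,b*a\in[1]\Theta$; (ii) if $a*b,b*a\in[1]\Theta$ and $\big((a*b)*b,(b*a)*a\big)\in\Theta$ then $(a,b)\in\Theta$.
   Context: For a poset $(P,\le)$ and $x,y\in P$, $L(x,y)=\{z\in P\mid z\le x,\ z\le y\}$. A poset is relatively pseudocomplemented if for all $x,y\in P$ there exists a greatest element $z$ of $P$ such that every element of $L(x,z)$ is $\le y$; this $z$ is denoted $x*y$. Such a poset has a greatest element $1$. An equivalence relation $\Theta$ is compatible with $*$ if $(a_1,b_1),(a_2,b_2)\in\Theta$ imply $(a_1*a_2,b_1*b_2)\in\Theta$; $[1]\Theta$ is the class of $1$. -}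

module Defs where

open import Level using (Level; _⊔_; suc)
open import Data.Product using (_×_)
open import Relation.Binary.Core using (Rel)
open import Relation.Binary.Structures using (IsPartialOrder; IsEquivalence)
open import Relation.Binary.PropositionalEquality using (_≡_)

InL : ∀ {a ℓ} {A : Set a} → Rel A ℓ → A → A → A → Set ℓ
InL _≤_ x y z = (z ≤ x) × (z ≤ y)

IsRelPseudocomplement : ∀ {a ℓ} {A : Set a} → Rel A ℓ → A → A → A → Set (a ⊔ ℓ)
IsRelPseudocomplement _≤_ x y r =
  (∀ w → InL _≤_ x r w → w ≤ y) ×
  (∀ z → (∀ w → InL _≤_ x z w → w ≤ y) → z ≤ r)

record RPCPoset (a ℓ : Level) : Set (suc (a ⊔ ℓ)) where
  field
    Carrier        : Set a
    _≤_            : Rel Carrier ℓ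
    isPartialOrder : IsPartialOrder _≡_ _≤_
    _*_            : Carrier → Carrier → Carrier
    *-rpc          : ∀ x y → IsRelPseudocomplement _≤_ x y (x * y)

Compatible : ∀ {a t} {A : Set a} → Rel A t → (A → A → A) → Set (a ⊔ t)
Compatible {A = A} Θ _*_ = ∀ {a₁ b₁ a₂ b₂ : A} → Θ a₁ b₁ → Θ a₂ b₂ → Θ (a₁ * a₂) (b₁ * b₂)

IsTop : ∀ {a ℓ} {A : Set a} → Rel A ℓ → A → Set (a ⊔ ℓ)
IsTop _≤_ t = ∀ x → x ≤ t

InClass : ∀ {a t} {A : Set a} → Rel A t → A → A → Set t
InClass Θ one x = Θ x one

{-# OPTIONS --safe #-}
module Submission where

open import Defs
open import Level using (Level)
open import Data.Product using (_×_; _,_; proj₁; proj₂)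
open import Relation.Binary.Core using (Rel)
open import Relation.Binary.Structures using (IsEquivalence; IsPartialOrder)
open import Relation.Binary.PropositionalEquality using (_≡_; subst)

module _ {c ℓ : Level} (P : RPCPoset c ℓ) where

  open RPCPoset P
  open IsPartialOrder isPartialOrder using (antisym; refl)

  *-unit : ∀ {one} → IsTop _≤_ one → ∀ x → x * x ≡ one
  *-unit one-top x = antisym (one-top (x * x)) (proj₂ (*-rpc x x) _ (λ _ → proj₁))

  *-identityˡ : ∀ {one} → IsTop _≤_ one → ∀ x → one * x ≡ x
  *-identityˡ {one} one-top x =
    antisym (proj₁ (*-rpc one x) (one * x) (one-top (one * x) , refl))
            (proj₂ (*-rpc one x) x (λ _ → proj₂))

  module CompatibleEquivalence {one : Carrier} (one-top : IsTop _≤_ one)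
           {t : Level} {Θ : Rel Carrier t} (Θ-equiv : IsEquivalence Θ)
           (Θ-compat : Compatible Θ _*_) where

    open IsEquivalence Θ-equiv renaming (refl to Θ-refl; sym to Θ-sym; trans to Θ-trans)

    related⇒*-∈[1] : ∀ {x y} → Θ x y → InClass Θ one (x * y)
    related⇒*-∈[1] {y = y} xΘy = subst (Θ _) (*-unit one-top y) (Θ-compat xΘy Θ-refl)

    ∈[1]⇒*-relatedʳ : ∀ {u} y → InClass Θ one u → Θ (u * y) y
    ∈[1]⇒*-relatedʳ y uΘ1 = subst (Θ _) (*-identityˡ one-top y) (Θ-compat uΘ1 Θ-refl)

    related-via-** : ∀ {a b} → InClass Θ one (a * b) → InClass Θ one (b * a) →
                     Θ ((a * b) * b) ((b * a) * a) → Θ a b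
    related-via-** {a} {b} a*b∈[1] b*a∈[1] a*b*bΘb*a*a =
      Θ-trans (Θ-sym (∈[1]⇒*-relatedʳ a b*a∈[1]))
              (Θ-trans (Θ-sym a*b*bΘb*a*a) (∈[1]⇒*-relatedʳ b a*b∈[1]))

lemma4p8 : ∀ {c ℓ t : Level} (P : RPCPoset c ℓ) → let open RPCPoset P in
    (one : Carrier) → IsTop _≤_ one →
    (Θ : Rel Carrier t) → IsEquivalence Θ → Compatible Θ _*_ →
    (a b : Carrier) →
    (Θ a b → InClass Θ one (a * b) × InClass Θ one (b * a)) ×
    (InClass Θ one (a * b) → InClass Θ one (b * a) →
      Θ ((a * b) * b) ((b * a) * a) → Θ a b)
lemma4p8 P one one-top Θ Θ-equiv Θ-compat a b =
  (λ aΘb → related⇒*-∈[1] aΘb , related⇒*-∈[1] (IsEquivalence.sym Θ-equiv aΘb)) ,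
  related-via-**
  where
  open CompatibleEquivalence P one-top Θ-equiv Θ-compat
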